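{- A marked permutation $\tau^{*}$ is insertable if and only if $\tau^{*} = \tau^{*}(\Pi)$ for some ordered set partition $\Pi$ (of the set of entries of $\tau^*$).
   Context: A marked permutation is a word of distinct positive integers ("cars") with some entries marked. A run of a word is a maximal contiguous increasing subword; runs of a marked permutation are those of the underlying word. Parking functions: a Dyck path of size $n$ goes from $(0,0)$ to $(n,n)$ with unit North/East steps weakly above $y=x$; a parking function is such a path with distinct positive cars, one in the cell immediately right of each North step, increasing upward in each column; the cell with lower-left corner $(i,j)$ lies in the $(j-i)$-diagonal; left/right refers to columns. A valley is an East step immediately followed by a North step such that the cell directly below the East step has no car or has a car smaller than the car next to that North step. A (valley-)marked parking function has a subset of valleys marked; the car next to a marked valley's North step is marked. Algorithm A, $\operatorname{Insert}(PF,c,k)$ (for $c\notin PF$, $(k+1)$-diagonal of $PF$ empty, $k$-diagonal containing no car smaller than $c$): the set of parking functions obtained by (1) for each car $s<c$ in the $(k-1)$-diagonal: move all cars in rows higher than $s$ up and right by one and place $c$ directly above $s$ (insert $NE$ after $s$'s North step, $c$ at the new North step); (2) for each car $b>c$ in the $k$-diagonal: move all cars in higher rows than $b$ up and right by one and place $c$ directly above and right of $b$ (insert $EN$ after $b$'s North step, $c$ at the new North step); (3) if $k=0$: move all cars up and right by one and put $c$ in the lower-left corner (prepend $NE$). Algorithm B, $\operatorname{Insert}^{*}(MPF,c,k)$ (for $c\notin MPF$, $k$-diagonal containing no marked car smaller than $c$): for each unmarked car $s<c$ in the $k$-diagonal and each unmarked car $b>c$ in the $(k+1)$-diagonal, look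 to the right of this car for the next time that either an unmarked car $b'>c$ appears in the $(k+1)$-diagonal or the path returns to the line $y=x+k$ (for $s$ with nothing directly above it, the latter happens immediately). In the first case shift $b'$ and every car in a higher row up and right by one and place a marked $c$ directly under $b'$; in the second case move all cars above this point up and right by one and place a marked $c$ in the cell directly right of and above this point (in the $k$-diagonal). The set of results is $\operatorname{Insert}^{*}(MPF,c,k)$. Insertion process for a marked permutation $\tau^*$ of length $n$: a car lying in the $(k+1)$-st run from the end of $\tau^*$ is inserted into the $k$-diagonal. Start with the set containing only the empty parking function. Process the unmarked cars of $\tau^*$ from right to left, replacing the current set $S$ by $\bigcup_{P\in S}\operatorname{Insert}(P,c,k)$; then process the marked cars of $\tau^*$ from right to left, replacing $S$ by $\bigcup_{P\in S}\operatorname{Insert}^{*}(P,c,k)$ (an insertion whose hypotheses fail contributes nothing). $\tau^*$ is insertable if the final set (of marked parking functions of size $n$) is nonempty. Ordered set partitions and $\tau^*(\Pi)$: for an ordered set partition $\Pi=(B_1,\dots,B_m)$ of a finite set of positive integers, define a word $\tau(\Pi)$ recursively: if $m=1$, $\tau(\Pi)$ lists $B_1$ increasingly; otherwise let $\Pi'=(B_2,\dots,B_m)$ and $r$ the first letter of $\tau(\Pi')$; then $\tau(\Pi)$ is the elements of $B_1$ larger than $r$ in increasing order, followed by the elements of $B_1$ smaller than $r$ in increasing order, followed by $\tau(\Pi')$. The marked word $\tau^*(\Pi)$ is $\tau(\Pi)$ with every entry marked except the leftmost entry of each block's (contiguous) segment. -}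

module Defs where

open import Data.Bool using (Bool; true; false; _∧_; _∨_; not; if_then_else_)
open import Data.Nat using (ℕ; zero; suc; _+_; _<_; _≡ᵇ_; _<ᵇ_; _≤ᵇ_)
open import Data.Product using (_×_; _,_; proj₁; ∃-syntax)
open import Data.List using (List; []; _∷_; _++_; map; concat; concatMap; reverse; filterᵇ)
open import Data.Bool.ListAction using (any)
open import Data.List.Relation.Unary.All using (All)
open import Data.List.Relation.Unary.Any using (Any)
open import Data.List.Relation.Unary.Linked using (Linked)
open import Data.List.Relation.Unary.AllPairs using (AllPairs)
open import Data.List.Relation.Unary.Unique.Propositional using (Unique)
open import Data.List.Membership.Propositional using (_∈_; _∉_)
open import Relation.Binary.PropositionalEquality using (_≡_; _≢_)

-- A marked word: list of (entry , marked?) ; true = marked.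
MarkedWord : Set
MarkedWord = List (ℕ × Bool)

IsMarkedPerm : MarkedWord → Set
IsMarkedPerm τ = Unique (map proj₁ τ) × All (λ x → 0 < x) (map proj₁ τ)

-- A (marked) parking function of size n is stored as its list of n rows,
-- from bottom to top.  Row i holds the car next to the i-th North step,
-- the index of the diagonal containing that car (= i - column), and
-- whether that car is marked.  Since every insertion below only adds a
-- row and shifts all higher rows up-and-right by one (which keeps their
-- diagonals), this representation determines the path and the cars.
record Row : Set where
  constructor row
  field
    car  : ℕ
    diag : ℕ
    mk   : Bool
open Row public

MPF : Set
MPF = List Row

insertAt : ℕ → Row → MPF → MPF
insertAt zero    x ys       = x ∷ ys
insertAt (suc i) x []       = x ∷ []
insertAt (suc i) x (y ∷ ys) = y ∷ insertAt i x ys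

hasCar : ℕ → MPF → Bool
hasCar c = any (λ r → car r ≡ᵇ c)

-- positions (row indices of the new car) produced by steps (1),(2):
-- j is the row index of the current head row.
insertPositionsA : ℕ → ℕ → ℕ → MPF → List ℕ
insertPositionsA c k j [] = []
insertPositionsA c k j (r ∷ rs) =
  (if ((suc (diag r) ≡ᵇ k) ∧ (car r <ᵇ c)) ∨ ((diag r ≡ᵇ k) ∧ (c <ᵇ car r))
     then suc j ∷ [] else [])
  ++ insertPositionsA c k (suc j) rs

hypA : MPF → ℕ → ℕ → Bool
hypA P c k =
  not (hasCar c P)
  ∧ not (any (λ r → diag r ≡ᵇ suc k) P)
  ∧ not (any (λ r → (diag r ≡ᵇ k) ∧ (car r <ᵇ c)) P)

Insert : MPF → ℕ → ℕ → List MPF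
Insert P c k =
  if hypA P c k
    then map (λ i → insertAt i (row c k false) P)
             (insertPositionsA c k 0 P ++ (if k ≡ᵇ 0 then 0 ∷ [] else []))
    else []

startB : ℕ → ℕ → Row → Bool
startB c k r =
  not (mk r) ∧ (((diag r ≡ᵇ k) ∧ (car r <ᵇ c)) ∨ ((diag r ≡ᵇ suc k) ∧ (c <ᵇ car r)))

-- the row before which the path (scanning rightwards/upwards) first
-- returns to y = x + k (a row in diagonal ≤ k, or the end of the path),
-- or which holds an unmarked car b' > c in the (k+1)-diagonal
stopB : ℕ → ℕ → Row → Bool
stopB c k r =
  (diag r ≤ᵇ k) ∨ ((diag r ≡ᵇ suc k) ∧ not (mk r) ∧ (c <ᵇ car r))

-- i = row index of the head of the remaining list
scanB : ℕ → ℕ → ℕ → MPF → ℕ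
scanB c k i [] = i
scanB c k i (r ∷ rs) = if stopB c k r then i else scanB c k (suc i) rs

insertPositionsB : ℕ → ℕ → ℕ → MPF → List ℕ
insertPositionsB c k j [] = []
insertPositionsB c k j (r ∷ rs) =
  (if startB c k r then scanB c k (suc j) rs ∷ [] else [])
  ++ insertPositionsB c k (suc j) rs

hypB : MPF → ℕ → ℕ → Bool
hypB P c k =
  not (hasCar c P)
  ∧ not (any (λ r → (diag r ≡ᵇ k) ∧ mk r ∧ (car r <ᵇ c)) P)

Insert* : MPF → ℕ → ℕ → List MPF
Insert* P c k =
  if hypB P c k
    then map (λ i → insertAt i (row c k true) P) (insertPositionsB c k 0 P)
    else []

descents : ℕ → List ℕ → ℕ
descents x [] = 0
descents x (y ∷ ys) = (if y <ᵇ x then 1 else 0) + descents y ys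

-- each entry together with its target diagonal k: the entry lies in the
-- (k+1)-st run from the end, i.e. k = number of descents weakly right of it
withDiag : MarkedWord → List (ℕ × Bool × ℕ)
withDiag [] = []
withDiag ((x , m) ∷ rest) = (x , m , descents x (map proj₁ rest)) ∷ withDiag rest

phaseA : List MPF → List (ℕ × Bool × ℕ) → List MPF
phaseA S [] = S
phaseA S ((c , true  , k) ∷ xs) = phaseA S xs
phaseA S ((c , false , k) ∷ xs) = phaseA (concatMap (λ P → Insert P c k) S) xs

phaseB : List MPF → List (ℕ × Bool × ℕ) → List MPF
phaseB S [] = S
phaseB S ((c , false , k) ∷ xs) = phaseB S xs
phaseB S ((c , true  , k) ∷ xs) = phaseB (concatMap (λ P → Insert* P c k) S) xs

insertionSet : MarkedWord → List MPF
insertionSet τ = phaseB (phaseA ([] ∷ []) rl) rl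
  where rl = reverse (withDiag τ)

Insertable : MarkedWord → Set
Insertable τ = ∃[ P ] (P ∈ insertionSet τ)

-- A block (finite set of positive integers) is represented by its
-- strictly increasing enumeration.
IsBlock : List ℕ → Set
IsBlock B = (B ≢ []) × Linked _<_ B

IsOrderedSetPartitionOf : List (List ℕ) → List ℕ → Set
IsOrderedSetPartitionOf Π S =
  All IsBlock Π
  × AllPairs (λ A B → ∀ {x} → x ∈ A → x ∉ B) Π
  × (∀ x → x ∈ S → Any (x ∈_) Π)
  × (∀ x → Any (x ∈_) Π → x ∈ S)

-- the segment of B_1 given the word τ(Π') that follows
arrange : List ℕ → List ℕ → List ℕ
arrange B [] = B
arrange B (r ∷ _) = filterᵇ (r <ᵇ_) B ++ filterᵇ (_<ᵇ r) B

segments : List (List ℕ) → List (List ℕ)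
segments [] = []
segments (B ∷ []) = B ∷ []
segments (B ∷ C ∷ Π) = arrange B (concat (segments (C ∷ Π))) ∷ segments (C ∷ Π)

tau : List (List ℕ) → List ℕ
tau Π = concat (segments Π)

markSegment : List ℕ → MarkedWord
markSegment [] = []
markSegment (x ∷ xs) = (x , false) ∷ map (λ y → (y , true)) xs

tauStar : List (List ℕ) → MarkedWord
tauStar Π = concatMap markSegment (segments Π)

-- Every parking function produced by the
--   insertion process has the same rows (car, diagonal, mark) up to order as the
--   cars inserted so far, and whether Insert / Insert* has any result depends only
--   on those rows.  So τ* is insertable iff no single insertion step gets stuck
--   when run on these canonical rows.
-- * Hosts (insertable⇔hosted).  The cars right of a car x lie weakly below x's
--   diagonal, and those in x's diagonal are larger.  Hence for a marked
--   permutation the hypotheses of both algorithms hold automatically, and a step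
--   succeeds iff the car has a host: an unmarked car in a neighbouring diagonal.
-- * Shape (hosted⇔shaped, shaped⇔partitioned).  The hosting conditions hold
--   exactly for words cut into segments, marked except for their first entry,
--   where a segment before the next segment head r is A ++ B with A, B increasing,
--   A above r and B below r.  This is the recursive shape of τ*(Π), and such
--   words (with distinct cars) are exactly the words τ*(Π).
module Submission where

open import Defs
open import Data.Nat using (ℕ; zero; suc; _+_; _<_; _≤_; _≡ᵇ_; _<ᵇ_)
open import Data.Nat.Properties
open import Data.Bool using (Bool; true; false; _∧_; _∨_; not; T; if_then_else_)
open import Data.Bool.Properties using (T?; ∨-comm; ∨-assoc; ∧-comm; ∧-assoc; ∧-zeroʳ; ∧-identityʳ; T-∧; T-∨; T-not-≡)
open import Data.Bool.ListAction using (any)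
open import Data.Product using (_×_; _,_; proj₁; proj₂; ∃-syntax)
open import Data.Product.Function.NonDependent.Propositional using (_×-⇔_)
open import Data.Sum using (_⊎_; inj₁; inj₂; [_,_]′)
open import Data.Sum.Function.Propositional using (_⊎-⇔_)
open import Data.Unit using (⊤; tt)
open import Data.Empty using (⊥-elim)
open import Function using (_∘_; const; id; case_of_)
open import Function.Construct.Composition using (_⇔-∘_)
open import Function.Construct.Identity using (⇔-id)
open import Relation.Nullary using (¬_)
open import Data.List using (List; []; _∷_; _++_; map; concat; concatMap; reverse; take; filterᵇ)
open import Data.List.Properties using (unfold-reverse; map-++; ++-assoc; ++-identityʳ; ++-conicalʳ; filter-++; filter-all; filter-none)
open import Data.List.Relation.Unary.All as All using (All; []; _∷_)
open import Data.List.Relation.Unary.All.Properties as Allₚ using (++⁺; All¬⇒¬Any)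
open import Data.List.Relation.Unary.Any as Any using (Any; here; there)
open import Data.List.Relation.Unary.Any.Properties using (any⁺; any⁻)
  renaming (++⁺ʳ to any-++⁺ʳ; ++⁻ to any-++⁻; ++-comm to any-++-comm)
open import Data.List.Relation.Unary.AllPairs using ([]; _∷_)
open import Data.List.Relation.Unary.Unique.Propositional using (Unique)
open import Data.List.Membership.Propositional using (_∈_; _∉_; lose)
open import Data.List.Membership.Propositional.Properties using (∈-++⁺ˡ; ∈-++⁺ʳ; ∈-++⁻)
open import Data.List.Relation.Unary.Linked as Linked using (Linked; []; [-]; _∷_)
open import Data.List.Relation.Unary.Linked.Properties as Linkedₚ using (Linked⇒All; Linked⇒AllPairs; AllPairs⇒Linked)
open import Data.List.Relation.Unary.AllPairs.Properties as AllPairsₚ using ()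
open import Data.List.Relation.Binary.Subset.Propositional using (_⊆_)
open import Function.Bundles using (_⇔_; mk⇔; Equivalence)
open Equivalence using (to; from)
open import Relation.Binary.PropositionalEquality
open ≡-Reasoning

-- P ∼ Q: no Boolean test on rows distinguishes P from Q, i.e. they have the
-- same rows up to order.  The hypotheses of Algorithms A and B are such tests,
-- and every result of an insertion has the rows of the input plus the new row.
infix 4 _∼_
record _∼_ (P Q : MPF) : Set where
  constructor mk∼
  field test : ∀ (f : Row → Bool) → any f P ≡ any f Q
open _∼_

∼-refl : ∀ {P} → P ∼ P
∼-refl = mk∼ λ f → refl

∼-trans : ∀ {P Q R} → P ∼ Q → Q ∼ R → P ∼ R
∼-trans P∼Q Q∼R = mk∼ λ f → trans (test P∼Q f) (test Q∼R f)

∼-cons : ∀ {P Q} x → P ∼ Q → x ∷ P ∼ x ∷ Q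
∼-cons x P∼Q = mk∼ λ f → cong (f x ∨_) (test P∼Q f)

insertAt-∼ : ∀ i x P → insertAt i x P ∼ x ∷ P
insertAt-∼ i x P = mk∼ (any-insertAt i x P)
  where
  any-insertAt : ∀ i x P f → any f (insertAt i x P) ≡ f x ∨ any f P
  any-insertAt zero    x P       f = refl
  any-insertAt (suc i) x []      f = refl
  any-insertAt (suc i) x (y ∷ P) f = begin
    f y ∨ any f (insertAt i x P)  ≡⟨ cong (f y ∨_) (any-insertAt i x P f) ⟩
    f y ∨ (f x ∨ any f P)         ≡⟨ sym (∨-assoc (f y) (f x) _) ⟩
    (f y ∨ f x) ∨ any f P         ≡⟨ cong (_∨ any f P) (∨-comm (f y) (f x)) ⟩
    (f x ∨ f y) ∨ any f P         ≡⟨ ∨-assoc (f x) (f y) _ ⟩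
    f x ∨ (f y ∨ any f P)         ∎

all-insertAt-∼ : ∀ x P is → All (_∼ x ∷ P) (map (λ i → insertAt i x P) is)
all-insertAt-∼ x P []       = []
all-insertAt-∼ x P (i ∷ is) = insertAt-∼ i x P ∷ all-insertAt-∼ x P is

nonEmpty : {A : Set} → List A → Bool
nonEmpty []      = false
nonEmpty (_ ∷ _) = true

nonEmpty-++ : {A : Set} (xs ys : List A) → nonEmpty (xs ++ ys) ≡ nonEmpty xs ∨ nonEmpty ys
nonEmpty-++ []      ys = refl
nonEmpty-++ (x ∷ xs) ys = refl

nonEmpty-map : {A B : Set} (g : A → B) (xs : List A) → nonEmpty (map g xs) ≡ nonEmpty xs
nonEmpty-map g []      = refl
nonEmpty-map g (x ∷ xs) = refl

nonEmpty⇔∈ : {A : Set} (xs : List A) → (∃[ x ] x ∈ xs) ⇔ T (nonEmpty xs)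
nonEmpty⇔∈ []       = mk⇔ (λ ()) (λ ())
nonEmpty⇔∈ (x ∷ xs) = mk⇔ _ (λ _ → x , here refl)

hostRowA : ℕ → ℕ → Row → Bool
hostRowA c k r = ((suc (diag r) ≡ᵇ k) ∧ (car r <ᵇ c)) ∨ ((diag r ≡ᵇ k) ∧ (c <ᵇ car r))

canInsert : MPF → ℕ → ℕ → Bool
canInsert P c k = hypA P c k ∧ (any (hostRowA c k) P ∨ (k ≡ᵇ 0))

canInsert* : MPF → ℕ → ℕ → Bool
canInsert* P c k = hypB P c k ∧ any (startB c k) P

positionsA-nonEmpty : ∀ c k j P → nonEmpty (insertPositionsA c k j P) ≡ any (hostRowA c k) P
positionsA-nonEmpty c k j []      = refl
positionsA-nonEmpty c k j (r ∷ P) with hostRowA c k r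
... | true  = refl
... | false = positionsA-nonEmpty c k (suc j) P

positionsB-nonEmpty : ∀ c k j P → nonEmpty (insertPositionsB c k j P) ≡ any (startB c k) P
positionsB-nonEmpty c k j []      = refl
positionsB-nonEmpty c k j (r ∷ P) with startB c k r
... | true  = refl
... | false = positionsB-nonEmpty c k (suc j) P

Insert-nonEmpty : ∀ P c k → nonEmpty (Insert P c k) ≡ canInsert P c k
Insert-nonEmpty P c k with hypA P c k
... | false = refl
... | true  = begin
  nonEmpty (map _ (insertPositionsA c k 0 P ++ corner k))
    ≡⟨ nonEmpty-map _ (insertPositionsA c k 0 P ++ corner k) ⟩
  nonEmpty (insertPositionsA c k 0 P ++ corner k)
    ≡⟨ nonEmpty-++ (insertPositionsA c k 0 P) (corner k) ⟩
  nonEmpty (insertPositionsA c k 0 P) ∨ nonEmpty (corner k)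
    ≡⟨ cong₂ _∨_ (positionsA-nonEmpty c k 0 P) (corner-nonEmpty k) ⟩
  any (hostRowA c k) P ∨ (k ≡ᵇ 0) ∎
  where
  -- step (3): the lower-left corner, available in the 0-diagonal only
  corner : ℕ → List ℕ
  corner d = if d ≡ᵇ 0 then 0 ∷ [] else []
  corner-nonEmpty : ∀ d → nonEmpty (corner d) ≡ (d ≡ᵇ 0)
  corner-nonEmpty zero    = refl
  corner-nonEmpty (suc d) = refl

Insert*-nonEmpty : ∀ P c k → nonEmpty (Insert* P c k) ≡ canInsert* P c k
Insert*-nonEmpty P c k with hypB P c k
... | false = refl
... | true  = trans (nonEmpty-map _ (insertPositionsB c k 0 P)) (positionsB-nonEmpty c k 0 P)

Insert-rows : ∀ P c k → All (_∼ row c k false ∷ P) (Insert P c k)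
Insert-rows P c k with hypA P c k
... | false = []
... | true  = all-insertAt-∼ _ P _

Insert*-rows : ∀ P c k → All (_∼ row c k true ∷ P) (Insert* P c k)
Insert*-rows P c k with hypB P c k
... | false = []
... | true  = all-insertAt-∼ _ P _

-- the success tests are Boolean tests on rows, so they only depend on P up to ∼
canInsert-resp : ∀ {P Q} c k → P ∼ Q → canInsert P c k ≡ canInsert Q c k
canInsert-resp c k P∼Q =
  cong₂ _∧_
    (cong₂ (λ a b → not a ∧ b) (test P∼Q (λ r → car r ≡ᵇ c))
      (cong₂ (λ a b → not a ∧ not b) (test P∼Q (λ r → diag r ≡ᵇ suc k))
                                     (test P∼Q (λ r → (diag r ≡ᵇ k) ∧ (car r <ᵇ c)))))
    (cong (_∨ (k ≡ᵇ 0)) (test P∼Q (hostRowA c k)))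

canInsert*-resp : ∀ {P Q} c k → P ∼ Q → canInsert* P c k ≡ canInsert* Q c k
canInsert*-resp c k P∼Q =
  cong₂ _∧_
    (cong₂ (λ a b → not a ∧ not b) (test P∼Q (λ r → car r ≡ᵇ c))
                                   (test P∼Q (λ r → (diag r ≡ᵇ k) ∧ mk r ∧ (car r <ᵇ c))))
    (test P∼Q (startB c k))

-- Hence if all members of
-- the current set S have the rows of L, the step succeeds on S iff `ok L` holds.
module InsertionStep (ins : MPF → List MPF) (r : Row) (ok : MPF → Bool)
    (ok-resp : ∀ {P Q} → P ∼ Q → ok P ≡ ok Q)
    (ins-rows : ∀ P → All (_∼ r ∷ P) (ins P))
    (ins-nonEmpty : ∀ P → nonEmpty (ins P) ≡ ok P) where

  step-rows : ∀ {L} S → All (_∼ L) S → All (_∼ r ∷ L) (concatMap ins S)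
  step-rows []      []          = []
  step-rows (P ∷ S) (P∼L ∷ S∼L) = ++⁺ (All.map (λ Q∼rP → ∼-trans Q∼rP (∼-cons r P∼L)) (ins-rows P))
                                      (step-rows S S∼L)

  step-nonEmpty : ∀ {L} S → All (_∼ L) S → nonEmpty (concatMap ins S) ≡ nonEmpty S ∧ ok L
  step-nonEmpty     []      []          = refl
  step-nonEmpty {L} (P ∷ S) (P∼L ∷ S∼L) = begin
    nonEmpty (ins P ++ concatMap ins S)       ≡⟨ nonEmpty-++ (ins P) _ ⟩
    nonEmpty (ins P) ∨ nonEmpty (concatMap ins S)
      ≡⟨ cong₂ _∨_ (trans (ins-nonEmpty P) (ok-resp P∼L)) (step-nonEmpty S S∼L) ⟩
    ok L ∨ (nonEmpty S ∧ ok L)                ≡⟨ absorb (ok L) (nonEmpty S) ⟩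
    ok L                                      ∎
    where
    absorb : ∀ a b → a ∨ (b ∧ a) ≡ a
    absorb true  b = refl
    absorb false b = ∧-zeroʳ b

-- A car of a marked word together with its marking and the diagonal it is
-- inserted into; `withDiag τ` lists these for τ from left to right.
Item : Set
Item = ℕ × Bool × ℕ

cars : MarkedWord → List ℕ
cars = map proj₁

unmarkedRows : List Item → MPF
unmarkedRows []                       = []
unmarkedRows ((c , true  , k) ∷ xs) = unmarkedRows xs
unmarkedRows ((c , false , k) ∷ xs) = row c k false ∷ unmarkedRows xs

markedRows : List Item → MPF
markedRows []                       = []
markedRows ((c , false , k) ∷ xs) = markedRows xs
markedRows ((c , true  , k) ∷ xs) = row c k true ∷ markedRows xs

-- phase 1 never gets stuck: each unmarked car can be inserted into the rows of
-- the unmarked cars to its right (which are inserted before it)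
okA : List Item → Bool
okA []                       = true
okA ((c , true  , k) ∷ xs) = okA xs
okA ((c , false , k) ∷ xs) = canInsert (unmarkedRows xs) c k ∧ okA xs

-- phase 2, started from parking functions with rows U, never gets stuck
okB : MPF → List Item → Bool
okB U []                       = true
okB U ((c , false , k) ∷ xs) = okB U xs
okB U ((c , true  , k) ∷ xs) = canInsert* (markedRows xs ++ U) c k ∧ okB U xs

phaseA-∷ʳ : ∀ S xs x → phaseA S (reverse (x ∷ xs)) ≡ phaseA (phaseA S (reverse xs)) (x ∷ [])
phaseA-∷ʳ S xs x = trans (cong (phaseA S) (unfold-reverse x xs)) (phaseA-++ S (reverse xs))
  where
  phaseA-++ : ∀ S ys → phaseA S (ys ++ x ∷ []) ≡ phaseA (phaseA S ys) (x ∷ [])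
  phaseA-++ S []                       = refl
  phaseA-++ S ((c , true  , k) ∷ ys) = phaseA-++ S ys
  phaseA-++ S ((c , false , k) ∷ ys) = phaseA-++ _ ys

phaseB-∷ʳ : ∀ S xs x → phaseB S (reverse (x ∷ xs)) ≡ phaseB (phaseB S (reverse xs)) (x ∷ [])
phaseB-∷ʳ S xs x = trans (cong (phaseB S) (unfold-reverse x xs)) (phaseB-++ S (reverse xs))
  where
  phaseB-++ : ∀ S ys → phaseB S (ys ++ x ∷ []) ≡ phaseB (phaseB S ys) (x ∷ [])
  phaseB-++ S []                       = refl
  phaseB-++ S ((c , false , k) ∷ ys) = phaseB-++ S ys
  phaseB-++ S ((c , true  , k) ∷ ys) = phaseB-++ _ ys

phaseA-sim : ∀ xs → let S = phaseA ([] ∷ []) (reverse xs) in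
  All (_∼ unmarkedRows xs) S × nonEmpty S ≡ okA xs
phaseA-sim [] = ∼-refl ∷ [] , refl
phaseA-sim ((c , true , k) ∷ xs)
  rewrite phaseA-∷ʳ ([] ∷ []) xs (c , true , k) = phaseA-sim xs
phaseA-sim ((c , false , k) ∷ xs)
  rewrite phaseA-∷ʳ ([] ∷ []) xs (c , false , k)
  with phaseA ([] ∷ []) (reverse xs) | phaseA-sim xs
... | S | S∼ , S≠[] =
  step-rows S S∼ , trans (step-nonEmpty S S∼) (trans (cong (_∧ _) S≠[]) (∧-comm (okA xs) _))
  where
  open InsertionStep (λ P → Insert P c k) (row c k false) (λ P → canInsert P c k)
         (canInsert-resp c k) (λ P → Insert-rows P c k) (λ P → Insert-nonEmpty P c k)

phaseB-sim : ∀ U S → All (_∼ U) S → ∀ xs → let S' = phaseB S (reverse xs) in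
  All (_∼ markedRows xs ++ U) S' × nonEmpty S' ≡ nonEmpty S ∧ okB U xs
phaseB-sim U S S∼ [] = S∼ , sym (∧-identityʳ (nonEmpty S))
phaseB-sim U S S∼ ((c , false , k) ∷ xs)
  rewrite phaseB-∷ʳ S xs (c , false , k) = phaseB-sim U S S∼ xs
phaseB-sim U S S∼ ((c , true , k) ∷ xs)
  rewrite phaseB-∷ʳ S xs (c , true , k)
  with phaseB S (reverse xs) | phaseB-sim U S S∼ xs
... | S' | S'∼ , S'≠[] = step-rows S' S'∼ , (begin
  nonEmpty (concatMap (λ P → Insert* P c k) S')  ≡⟨ step-nonEmpty S' S'∼ ⟩
  nonEmpty S' ∧ ok             ≡⟨ cong (_∧ ok) S'≠[] ⟩
  (nonEmpty S ∧ okB U xs) ∧ ok ≡⟨ ∧-assoc (nonEmpty S) _ _ ⟩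
  nonEmpty S ∧ (okB U xs ∧ ok) ≡⟨ cong (nonEmpty S ∧_) (∧-comm (okB U xs) ok) ⟩
  nonEmpty S ∧ (ok ∧ okB U xs) ∎)
  where
  open InsertionStep (λ P → Insert* P c k) (row c k true) (λ P → canInsert* P c k)
         (canInsert*-resp c k) (λ P → Insert*-rows P c k) (λ P → Insert*-nonEmpty P c k)
  ok = canInsert* (markedRows xs ++ U) c k

insertable⇔ok : ∀ τ → let xs = withDiag τ in
  Insertable τ ⇔ T (okA xs ∧ okB (unmarkedRows xs) xs)
insertable⇔ok τ = subst (λ b → Insertable τ ⇔ T b) nonEmpty-result (nonEmpty⇔∈ (insertionSet τ))
  where
  xs = withDiag τ
  nonEmpty-result : nonEmpty (insertionSet τ) ≡ okA xs ∧ okB (unmarkedRows xs) xs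
  nonEmpty-result with phaseA-sim xs
  ... | S∼ , S≠[] = trans (proj₂ (phaseB-sim (unmarkedRows xs) _ S∼ xs))
                          (cong (_∧ okB (unmarkedRows xs) xs) S≠[])

-- The diagonal of a car is the number of descents weakly right of it, and
-- runs increase: every car right of x lies weakly below x's diagonal k, and the
-- ones in diagonal k are larger than x.
Below : ℕ → ℕ → Item → Set
Below x k (c , m , d) = d ≤ k × (d ≡ k → x ≤ c)

later-below : ∀ x τ → All (Below x (descents x (cars τ))) (withDiag τ)
later-below x []            = []
later-below x ((y , m) ∷ τ) with y <ᵇ x in y<ᵇx
... | true  = (n≤1+n _ , λ k≡1+k → ⊥-elim (1+n≢n (sym k≡1+k)))
            ∷ All.map (λ {it} → drop-below {it}) (later-below y τ)
  where
  drop-below : ∀ {it} → Below y (descents y (cars τ)) it → Below x (suc (descents y (cars τ))) it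
  drop-below (d≤k , _) = m≤n⇒m≤1+n d≤k , λ d≡1+k → ⊥-elim (1+n≰n (subst (_≤ _) d≡1+k d≤k))
... | false = (≤-refl , const x≤y) ∷ All.map (λ {it} → stay-below {it}) (later-below y τ)
  where
  x≤y : x ≤ y
  x≤y = ≮⇒≥ (λ y<x → subst T y<ᵇx (<⇒<ᵇ y<x))
  stay-below : ∀ {it} → Below y (descents y (cars τ)) it → Below x (descents y (cars τ)) it
  stay-below (d≤k , y≤) = d≤k , λ d≡k → ≤-trans x≤y (y≤ d≡k)

later-cars-differ : ∀ {x} τ → All (x ≢_) (cars τ) → All (λ it → x ≢ proj₁ it) (withDiag τ)
later-cars-differ []            []         = []
later-cars-differ ((y , m) ∷ τ) (x≢y ∷ ps) = x≢y ∷ later-cars-differ τ ps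

rowOf : Item → Row
rowOf (c , m , k) = row c k m

Unmarked : Item → Set
Unmarked (c , m , k) = m ≡ false

all-unmarkedRows : ∀ {P : Row → Set} xs → All (λ it → Unmarked it → P (rowOf it)) xs →
  All P (unmarkedRows xs)
all-unmarkedRows []                       []       = []
all-unmarkedRows ((c , true  , k) ∷ xs) (_ ∷ ps) = all-unmarkedRows xs ps
all-unmarkedRows ((c , false , k) ∷ xs) (p ∷ ps) = p refl ∷ all-unmarkedRows xs ps

Marked : Item → Set
Marked (c , m , k) = m ≡ true

all-markedRows : ∀ {P : Row → Set} xs → All (λ it → Marked it → P (rowOf it)) xs →
  All P (markedRows xs)
all-markedRows []                       []       = []
all-markedRows ((c , false , k) ∷ xs) (_ ∷ ps) = all-markedRows xs ps
all-markedRows ((c , true  , k) ∷ xs) (p ∷ ps) = p refl ∷ all-markedRows xs ps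

any-unmarkedRows⁺ : ∀ {P : Row → Set} xs → Any (λ it → Unmarked it × P (rowOf it)) xs →
  Any P (unmarkedRows xs)
any-unmarkedRows⁺ ((c , false , k) ∷ xs) (here (_ , p)) = here p
any-unmarkedRows⁺ ((c , true  , k) ∷ xs) (there q)      = any-unmarkedRows⁺ xs q
any-unmarkedRows⁺ ((c , false , k) ∷ xs) (there q)      = there (any-unmarkedRows⁺ xs q)

any-unmarkedRows⁻ : ∀ {P : Row → Set} xs → Any P (unmarkedRows xs) →
  Any (λ it → Unmarked it × P (rowOf it)) xs
any-unmarkedRows⁻ ((c , true  , k) ∷ xs) q         = there (any-unmarkedRows⁻ xs q)
any-unmarkedRows⁻ ((c , false , k) ∷ xs) (here p)  = here (refl , p)
any-unmarkedRows⁻ ((c , false , k) ∷ xs) (there q) = there (any-unmarkedRows⁻ xs q)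

T-not⁺ : ∀ {b} → ¬ T b → T (not b)
T-not⁺ {false} _  = tt
T-not⁺ {true}  ¬t = ¬t tt

noRow : ∀ (f : Row → Bool) {L} → All (λ r → ¬ T (f r)) L → T (not (any f L))
noRow f {L} none = T-not⁺ (All¬⇒¬Any none ∘ any⁻ f L)

T-≡ᵇ : ∀ m n → T (m ≡ᵇ n) ⇔ (m ≡ n)
T-≡ᵇ m n = mk⇔ (≡ᵇ⇒≡ m n) (≡⇒≡ᵇ m n)

T-<ᵇ : ∀ m n → T (m <ᵇ n) ⇔ (m < n)
T-<ᵇ m n = mk⇔ (<ᵇ⇒< m n) <⇒<ᵇ

T-≡ᵇ∧<ᵇ : ∀ m n a b → T ((m ≡ᵇ n) ∧ (a <ᵇ b)) ⇔ (m ≡ n × a < b)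
T-≡ᵇ∧<ᵇ m n a b = (T-≡ᵇ m n ×-⇔ T-<ᵇ a b) ⇔-∘ T-∧ {m ≡ᵇ n} {a <ᵇ b}

HostA : ℕ → ℕ → Item → Set
HostA c k (s , m , d) = m ≡ false × ((suc d ≡ k × s < c) ⊎ (d ≡ k × c < s))

HostB : ℕ → ℕ → Item → Set
HostB c k (s , m , d) = m ≡ false × ((d ≡ k × s < c) ⊎ (d ≡ suc k × c < s))

hostA⇔ : ∀ c k it → (Unmarked it × T (hostRowA c k (rowOf it))) ⇔ HostA c k it
hostA⇔ c k (s , m , d) =
  ⇔-id _ ×-⇔ ((T-≡ᵇ∧<ᵇ (suc d) k s c ⊎-⇔ T-≡ᵇ∧<ᵇ d k c s)
               ⇔-∘ T-∨ {(suc d ≡ᵇ k) ∧ (s <ᵇ c)} {(d ≡ᵇ k) ∧ (c <ᵇ s)})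

hostB⇔ : ∀ c k it → T (startB c k (rowOf it)) ⇔ HostB c k it
hostB⇔ c k (s , m , d) =
  (T-not-≡ ×-⇔ ((T-≡ᵇ∧<ᵇ d k s c ⊎-⇔ T-≡ᵇ∧<ᵇ d (suc k) c s)
                 ⇔-∘ T-∨ {(d ≡ᵇ k) ∧ (s <ᵇ c)} {(d ≡ᵇ suc k) ∧ (c <ᵇ s)}))
  ⇔-∘ T-∧ {not m} {((d ≡ᵇ k) ∧ (s <ᵇ c)) ∨ ((d ≡ᵇ suc k) ∧ (c <ᵇ s))}

HostedA : List Item → Set
HostedA []                       = ⊤
HostedA ((c , true  , k) ∷ xs) = HostedA xs
HostedA ((c , false , k) ∷ xs) = (k ≡ 0 ⊎ Any (HostA c k) xs) × HostedA xs

MarkedHosted : List Item → Item → Set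
MarkedHosted U (c , m , k) = m ≡ true → Any (HostB c k) U

HostedB : List Item → List Item → Set
HostedB U xs = All (MarkedHosted U) xs

Hosted : List Item → Set
Hosted xs = HostedA xs × HostedB xs xs

hostA-available : ∀ c k xs →
  T (any (hostRowA c k) (unmarkedRows xs) ∨ (k ≡ᵇ 0)) ⇔ (k ≡ 0 ⊎ Any (HostA c k) xs)
hostA-available c k xs = mk⇔
  (λ t → [ inj₂ ∘ from-rows , inj₁ ∘ ≡ᵇ⇒≡ k 0 ]′ (to (T-∨ {any (hostRowA c k) (unmarkedRows xs)}) t))
  (λ h → from (T-∨ {any (hostRowA c k) (unmarkedRows xs)}) ([ inj₂ ∘ ≡⇒≡ᵇ k 0 , inj₁ ∘ to-rows ]′ h))
  where
  from-rows : T (any (hostRowA c k) (unmarkedRows xs)) → Any (HostA c k) xs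
  from-rows = Any.map (to (hostA⇔ c k _)) ∘ any-unmarkedRows⁻ xs ∘ any⁻ _ _
  to-rows : Any (HostA c k) xs → T (any (hostRowA c k) (unmarkedRows xs))
  to-rows = any⁺ _ ∘ any-unmarkedRows⁺ xs ∘ Any.map (from (hostA⇔ c k _))

okA→hostedA : ∀ xs → T (okA xs) → HostedA xs
okA→hostedA []                       _ = tt
okA→hostedA ((c , true  , k) ∷ xs) t = okA→hostedA xs t
okA→hostedA ((c , false , k) ∷ xs) t with to (T-∧ {canInsert (unmarkedRows xs) c k}) t
... | can , rest =
  to (hostA-available c k xs) (proj₂ (to (T-∧ {hypA (unmarkedRows xs) c k}) can)) , okA→hostedA xs rest

okB→hostedB : ∀ U xs → T (okB (unmarkedRows U) xs) → HostedB U xs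
okB→hostedB U []                       _ = []
okB→hostedB U ((c , false , k) ∷ xs) t = (λ ()) ∷ okB→hostedB U xs t
okB→hostedB U ((c , true  , k) ∷ xs) t with to (T-∧ {canInsert* (markedRows xs ++ unmarkedRows U) c k}) t
... | can , rest = const host ∷ okB→hostedB U xs rest
  where
  start : T (any (startB c k) (markedRows xs ++ unmarkedRows U))
  start = proj₂ (to (T-∧ {hypB (markedRows xs ++ unmarkedRows U) c k}) can)
  marked-no-start : ∀ ys → ¬ Any (T ∘ startB c k) (markedRows ys)
  marked-no-start ((c' , false , k') ∷ ys) a         = marked-no-start ys a
  marked-no-start ((c' , true  , k') ∷ ys) (there a) = marked-no-start ys a
  host : Any (HostB c k) U
  host with any-++⁻ (markedRows xs) (any⁻ (startB c k) _ start)
  ... | inj₁ a = ⊥-elim (marked-no-start xs a)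
  ... | inj₂ a = Any.map (to (hostB⇔ c k _) ∘ proj₂) (any-unmarkedRows⁻ U a)

below-not-higher : ∀ {x k} it → Below x k it → ¬ T (diag (rowOf it) ≡ᵇ suc k)
below-not-higher {k = k} (c , m , d) (d≤k , _) t = 1+n≰n (subst (_≤ k) (≡ᵇ⇒≡ d (suc k) t) d≤k)

below-not-smaller : ∀ {x k} it → Below x k it → ¬ T ((diag (rowOf it) ≡ᵇ k) ∧ (car (rowOf it) <ᵇ x))
below-not-smaller {x} {k} (c , m , d) (_ , x≤c) t with to (T-≡ᵇ∧<ᵇ d k c x) t
... | d≡k , c<x = <⇒≱ c<x (x≤c d≡k)

differ-not-equal : ∀ {x} it → x ≢ proj₁ it → ¬ T (car (rowOf it) ≡ᵇ x)
differ-not-equal (c , m , d) x≢c t = x≢c (sym (≡ᵇ⇒≡ c _ t))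

-- conversely, in a marked permutation the hypotheses of Algorithm A always hold,
-- so a car with a host can be inserted
hostedA→okA : ∀ τ → Unique (cars τ) → HostedA (withDiag τ) → T (okA (withDiag τ))
hostedA→okA []               _           _           = tt
hostedA→okA ((x , true) ∷ τ)  (_ ∷ u)     h           = hostedA→okA τ u h
hostedA→okA ((x , false) ∷ τ) (x∉τ ∷ u) (host , h) =
  from T-∧ (from T-∧ (hypotheses , from (hostA-available x k xs) host) , hostedA→okA τ u h)
  where
  k = descents x (cars τ)
  xs = withDiag τ
  later : ∀ {P : Row → Set} → (∀ it → Below x k it → x ≢ proj₁ it → P (rowOf it)) → All P (unmarkedRows xs)
  later p = all-unmarkedRows xs
    (All.zipWith (λ {it} (b , d) _ → p it b d) (later-below x τ , later-cars-differ τ x∉τ))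
  hypotheses : T (hypA (unmarkedRows xs) x k)
  hypotheses = from T-∧
    ( noRow _ (later (λ it _ → differ-not-equal it))
    , from T-∧ (noRow _ (later (λ it b _ → below-not-higher it b))
              , noRow _ (later (λ it b _ → below-not-smaller it b))))

MarkedApart : List Item → ℕ × Bool → Set
MarkedApart U (x , m) = m ≡ true → All (λ it → Unmarked it → x ≢ proj₁ it) U

marked-apart : ∀ τ → Unique (cars τ) → All (MarkedApart (withDiag τ)) τ
marked-apart []            []         = []
marked-apart ((x , m) ∷ τ) (x∉τ ∷ u) =
  head-apart ∷ All.zipWith extend (Allₚ.map⁻ x∉τ , marked-apart τ u)
  where
  head-apart : MarkedApart (withDiag ((x , m) ∷ τ)) (x , m)
  head-apart m≡true = (λ m≡false _ → case trans (sym m≡true) m≡false of λ ())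
                    ∷ All.map (λ x≢c _ → x≢c) (later-cars-differ τ x∉τ)
  extend : ∀ {p} → x ≢ proj₁ p × MarkedApart (withDiag τ) p → MarkedApart (withDiag ((x , m) ∷ τ)) p
  extend (x≢y , apart) m≡true = (λ _ → x≢y ∘ sym) ∷ apart m≡true

hostedB→okB : ∀ U τ → Unique (cars τ) → All (MarkedApart U) τ → HostedB U (withDiag τ) →
  T (okB (unmarkedRows U) (withDiag τ))
hostedB→okB U []               _          _             _           = tt
hostedB→okB U ((x , false) ∷ τ) (_ ∷ u)   (_ ∷ apart)   (_ ∷ h)     = hostedB→okB U τ u apart h
hostedB→okB U ((x , true) ∷ τ)  (x∉τ ∷ u) (x-apart ∷ apart) (host ∷ h) =
  from T-∧ (from T-∧ (from T-∧ (fresh , no-smaller-marked) , start) , hostedB→okB U τ u apart h)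
  where
  k = descents x (cars τ)
  xs = withDiag τ
  fresh : T (not (hasCar x (markedRows xs ++ unmarkedRows U)))
  fresh = noRow _
    (++⁺ (all-markedRows xs (All.map (λ {it} d _ → differ-not-equal it d) (later-cars-differ τ x∉τ)))
         (all-unmarkedRows U (All.map (λ {it} d u → differ-not-equal it (d u)) (x-apart refl))))
  MarkedSmaller : Row → Bool
  MarkedSmaller r = (diag r ≡ᵇ k) ∧ mk r ∧ (car r <ᵇ x)
  marked-not-smaller : ∀ it → Below x k it → Marked it → ¬ T (MarkedSmaller (rowOf it))
  marked-not-smaller (c , .true , d) b refl = below-not-smaller (c , true , d) b
  unmarked-not-marked : ∀ it → Unmarked it → ¬ T (MarkedSmaller (rowOf it))
  unmarked-not-marked (c , .false , d) refl t = proj₂ (to (T-∧ {d ≡ᵇ k} {false}) t)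
  no-smaller-marked : T (not (any MarkedSmaller (markedRows xs ++ unmarkedRows U)))
  no-smaller-marked = noRow MarkedSmaller
    (++⁺ (all-markedRows xs (All.map (λ {it} → marked-not-smaller it) (later-below x τ)))
         (all-unmarkedRows U (All.tabulate (λ {it} _ → unmarked-not-marked it))))
  start : T (any (startB x k) (markedRows xs ++ unmarkedRows U))
  start = any⁺ _ (any-++⁺ʳ (markedRows xs)
            (any-unmarkedRows⁺ U (Any.map (λ {it} b → unmarked it b , from (hostB⇔ x k it) b) (host refl))))
    where
    unmarked : ∀ it → HostB x k it → Unmarked it
    unmarked (s , m , d) (m≡false , _) = m≡false

insertable⇔hosted : ∀ τ → IsMarkedPerm τ → Insertable τ ⇔ Hosted (withDiag τ)
insertable⇔hosted τ (u , _) = mk⇔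
  (λ ins → let okA-holds , okB-holds = to (T-∧ {okA xs}) (to (insertable⇔ok τ) ins) in
           okA→hostedA xs okA-holds , okB→hostedB xs xs okB-holds)
  (λ (hostedA , hostedB) → from (insertable⇔ok τ)
     (from T-∧ (hostedA→okA τ u hostedA , hostedB→okB xs τ u (marked-apart τ u) hostedB)))
  where xs = withDiag τ

marked : List ℕ → MarkedWord
marked = map (λ y → y , true)

cars-marked : ∀ bs → cars (marked bs) ≡ bs
cars-marked []       = refl
cars-marked (b ∷ bs) = cong (b ∷_) (cars-marked bs)

above-first : ∀ {x xs} → Linked _<_ (x ∷ xs) → All (x <_) xs
above-first [-]           = []
above-first (x<y ∷ rest) = Linked⇒All <-trans x<y rest

no-descent : ∀ {x y} → x < y → (y <ᵇ x) ≡ false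
no-descent {x} {y} x<y with y <ᵇ x in y<ᵇx
... | false = refl
... | true  = ⊥-elim (<⇒≯ x<y (<ᵇ⇒< y x (subst T (sym y<ᵇx) tt)))

descent : ∀ {x y} → y < x → (y <ᵇ x) ≡ true
descent {x} {y} y<x with y <ᵇ x in y<ᵇx
... | true  = refl
... | false = ⊥-elim (subst T y<ᵇx (<⇒<ᵇ y<x))

below-last : ∀ {r} xs → Linked _<_ (xs ++ r ∷ []) → All (_< r) xs
below-last []           _           = []
below-last (x ∷ [])     (x<r ∷ _)  = x<r ∷ []
below-last (x ∷ y ∷ xs) (x<y ∷ l)  with below-last (y ∷ xs) l
... | y<r ∷ xs<r = <-trans x<y y<r ∷ y<r ∷ xs<r

extend-below : ∀ {r} xs → Linked _<_ xs → All (_< r) xs → Linked _<_ (xs ++ r ∷ [])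
extend-below []           _          _           = [-]
extend-below (x ∷ [])     _          (x<r ∷ _)  = x<r ∷ [-]
extend-below (x ∷ y ∷ xs) (x<y ∷ l) (_ ∷ y<r)  = x<y ∷ extend-below (y ∷ xs) l y<r

-- the diagonal of the first car of a word (nothing right of it: diagonal 0)
leadDiag : List ℕ → ℕ
leadDiag []       = 0
leadDiag (z ∷ zs) = descents z zs

descents-run : ∀ x ys zs → Linked _<_ (x ∷ ys ++ take 1 zs) → descents x (ys ++ zs) ≡ leadDiag zs
descents-run x []       []       _           = refl
descents-run x []       (z ∷ zs) (x<z ∷ _)  rewrite no-descent x<z = refl
descents-run x (y ∷ ys) zs       (x<y ∷ l)  rewrite no-descent x<y = descents-run y ys zs l

descents-fall : ∀ a as B r zs → Linked _<_ (a ∷ as) → All (r <_) (a ∷ as) → Linked _<_ (B ++ r ∷ []) →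
  descents a (as ++ B ++ r ∷ zs) ≡ suc (descents r zs)
descents-fall a []        []      r zs _          (r<a ∷ _) _ rewrite descent r<a = refl
descents-fall a []        (b ∷ B) r zs _          (r<a ∷ _) l
  rewrite descent (<-trans (All.head (below-last (b ∷ B) l)) r<a) = cong suc (descents-run b B (r ∷ zs) l)
descents-fall a (a' ∷ as) B       r zs (a<a' ∷ l) (_ ∷ r<as) lB
  rewrite no-descent a<a' = descents-fall a' as B r zs l r<as lB

label : ℕ → ℕ × Bool → Item
label k (x , m) = x , m , k

withDiag-run : ∀ σ ρ → Linked _<_ (cars σ ++ take 1 (cars ρ)) →
  withDiag (σ ++ ρ) ≡ map (label (leadDiag (cars ρ))) σ ++ withDiag ρ
withDiag-run []            ρ _ = refl
withDiag-run ((x , m) ∷ σ) ρ l =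
  cong₂ _∷_ (cong (λ k → x , m , k) diag-x) (withDiag-run σ ρ (Linked.tail l))
  where
  diag-x : descents x (cars (σ ++ ρ)) ≡ leadDiag (cars ρ)
  diag-x = trans (cong (descents x) (map-++ proj₁ σ ρ)) (descents-run x (cars σ) (cars ρ) l)

withDiag-fall : ∀ σ B r m ρ → Linked _<_ (cars σ) → All (r <_) (cars σ) → Linked _<_ (B ++ r ∷ []) →
  withDiag (σ ++ marked B ++ (r , m) ∷ ρ)
    ≡ map (label (suc (descents r (cars ρ)))) σ ++ withDiag (marked B ++ (r , m) ∷ ρ)
withDiag-fall []            B r m ρ _ _          _  = refl
withDiag-fall ((x , m') ∷ σ) B r m ρ l r<σ lB =
  cong₂ _∷_ (cong (λ k → x , m' , k) diag-x) (withDiag-fall σ B r m ρ (Linked.tail l) (All.tail r<σ) lB)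
  where
  cars-rest : cars (σ ++ marked B ++ (r , m) ∷ ρ) ≡ cars σ ++ B ++ r ∷ cars ρ
  cars-rest = begin
    cars (σ ++ marked B ++ (r , m) ∷ ρ)         ≡⟨ map-++ proj₁ σ _ ⟩
    cars σ ++ cars (marked B ++ (r , m) ∷ ρ)    ≡⟨ cong (cars σ ++_) (map-++ proj₁ (marked B) _) ⟩
    cars σ ++ cars (marked B) ++ r ∷ cars ρ     ≡⟨ cong (λ bs → cars σ ++ bs ++ r ∷ cars ρ) (cars-marked B) ⟩
    cars σ ++ B ++ r ∷ cars ρ                   ∎
  diag-x : descents x (cars (σ ++ marked B ++ (r , m) ∷ ρ)) ≡ suc (descents r (cars ρ))
  diag-x = trans (cong (descents x) cars-rest) (descents-fall x (cars σ) B r (cars ρ) l r<σ lB)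

-- The shape of the words τ*(Π): a sequence of segments, each marked except for
-- its first entry.
data Shaped : MarkedWord → Set where
  final : ∀ w → Linked _<_ w → Shaped (markSegment w)
  more  : ∀ A B r ρ → Linked _<_ A → Linked _<_ B → All (r <_) A → All (_< r) B →
          Shaped ((r , false) ∷ ρ) → Shaped (markSegment (A ++ B) ++ (r , false) ∷ ρ)

HostedBy : Item → Item → Set
HostedBy hI (b , m , k) = HostB b k hI

labelled-marked : ∀ k bs → All Marked (map (label k) (marked bs))
labelled-marked k []       = []
labelled-marked k (b ∷ bs) = refl ∷ labelled-marked k bs

labelled-hosted : ∀ hI k bs → All (λ b → HostB b k hI) bs → All (HostedBy hI) (map (label k) (marked bs))
labelled-hosted hI k []       []       = []
labelled-hosted hI k (b ∷ bs) (p ∷ ps) = p ∷ labelled-hosted hI k bs ps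

hostedA-marked : ∀ ms ys → All Marked ms → HostedA ys → HostedA (ms ++ ys)
hostedA-marked []                  ys []          h = h
hostedA-marked ((c , m , k) ∷ ms) ys (refl ∷ ps) h = hostedA-marked ms ys ps h

segment-hosted : ∀ {U xs} h k ms ys → xs ≡ (h , false , k) ∷ ms ++ ys → xs ⊆ U →
  All Marked ms → All (HostedBy (h , false , k)) ms → (k ≡ 0 ⊎ Any (HostA h k) ys) →
  (ys ⊆ U → HostedA ys × HostedB U ys) → HostedA xs × HostedB U xs
segment-hosted h k ms ys refl xs⊆U ms-marked ms-hosted head-hosted rest
  with rest (xs⊆U ∘ there ∘ ∈-++⁺ʳ ms)
... | ys-hostedA , ys-hostedB =
  ( [ inj₁ , inj₂ ∘ any-++⁺ʳ ms ]′ head-hosted , hostedA-marked ms ys ms-marked ys-hostedA )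
  , (λ ()) ∷ ++⁺ (All.map (λ {it} → hosted-in-U it) ms-hosted) ys-hostedB
  where
  hosted-in-U : ∀ it → HostedBy (h , false , k) it → MarkedHosted _ it
  hosted-in-U (b , m , kb) host _ = lose (xs⊆U (here refl)) host

cars-segment : ∀ h m bs → cars ((h , m) ∷ marked bs) ≡ h ∷ bs
cars-segment h m bs = cong (h ∷_) (cars-marked bs)

shaped→hosted : ∀ {τ} → Shaped τ → ∀ {U} → withDiag τ ⊆ U → HostedA (withDiag τ) × HostedB U (withDiag τ)
shaped→hosted (final [] _) _ = tt , []
shaped→hosted (final (h ∷ w) l) ⊆U =
  segment-hosted h 0 (map (label 0) (marked w)) [] diagonals ⊆U (labelled-marked 0 w)
    (labelled-hosted _ 0 w (All.map (λ h<b → refl , inj₁ (refl , h<b)) (above-first l)))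
    (inj₁ refl) (λ _ → tt , [])
  where
  σ = (h , false) ∷ marked w
  diagonals : withDiag σ ≡ (h , false , 0) ∷ map (label 0) (marked w) ++ []
  diagonals = begin
    withDiag σ          ≡⟨ cong withDiag (sym (++-identityʳ σ)) ⟩
    withDiag (σ ++ [])  ≡⟨ withDiag-run σ [] (subst (Linked _<_) (sym (trans (++-identityʳ _) (cars-segment h false w))) l) ⟩
    map (label 0) σ ++ [] ∎
shaped→hosted (more [] [] r ρ _ _ _ _ s) ⊆U = shaped→hosted s ⊆U
shaped→hosted (more [] (h ∷ B) r ρ _ lB _ B<r s) ⊆U =
  segment-hosted h k (map (label k) (marked B)) (withDiag ((r , false) ∷ ρ)) diagonals ⊆U
    (labelled-marked k B)
    (labelled-hosted _ k B (All.map (λ h<b → refl , inj₁ (refl , h<b)) (above-first lB)))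
    (inj₂ (here (refl , inj₂ (refl , All.head B<r)))) (shaped→hosted s)
  where
  k = descents r (cars ρ)
  diagonals : withDiag (((h , false) ∷ marked B) ++ (r , false) ∷ ρ)
            ≡ (h , false , k) ∷ map (label k) (marked B) ++ withDiag ((r , false) ∷ ρ)
  diagonals = withDiag-run ((h , false) ∷ marked B) ((r , false) ∷ ρ)
    (subst (λ hB → Linked _<_ (hB ++ r ∷ [])) (sym (cars-segment h false B)) (extend-below (h ∷ B) lB B<r))
shaped→hosted (more (h ∷ A) B r ρ lA lB A>r B<r s) ⊆U =
  segment-hosted h (suc k) (map (label (suc k)) (marked A) ++ map (label k) (marked B))
    (withDiag ρ′) diagonals ⊆U
    (++⁺ (labelled-marked (suc k) A) (labelled-marked k B))
    (++⁺ (labelled-hosted _ (suc k) A (All.map (λ h<a → refl , inj₁ (refl , h<a)) (above-first lA)))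
         (labelled-hosted _ k B (All.map (λ b<r → refl , inj₂ (refl , <-trans b<r r<h)) B<r)))
    (inj₂ (here (refl , inj₁ (refl , r<h)))) (shaped→hosted s)
  where
  k = descents r (cars ρ)
  ρ′ = (r , false) ∷ ρ
  r<h = All.head A>r
  lB′ : Linked _<_ (B ++ r ∷ [])
  lB′ = extend-below B lB B<r
  diagonals : withDiag ((h , false) ∷ marked (A ++ B) ++ ρ′)
            ≡ (h , false , suc k) ∷ (map (label (suc k)) (marked A) ++ map (label k) (marked B)) ++ withDiag ρ′
  diagonals = begin
    withDiag ((h , false) ∷ marked (A ++ B) ++ ρ′)
      ≡⟨ cong (λ bs → withDiag ((h , false) ∷ bs)) (trans (cong (_++ ρ′) (map-++ _ A B)) (++-assoc (marked A) _ _)) ⟩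
    withDiag (((h , false) ∷ marked A) ++ marked B ++ ρ′)
      ≡⟨ withDiag-fall ((h , false) ∷ marked A) B r false ρ
           (subst (Linked _<_) (sym (cars-segment h false A)) lA)
           (subst (All (r <_)) (sym (cars-segment h false A)) A>r) lB′ ⟩
    map (label (suc k)) ((h , false) ∷ marked A) ++ withDiag (marked B ++ ρ′)
      ≡⟨ cong (map (label (suc k)) ((h , false) ∷ marked A) ++_)
              (withDiag-run (marked B) ρ′ (subst (λ bs → Linked _<_ (bs ++ r ∷ [])) (sym (cars-marked B)) lB′)) ⟩
    map (label (suc k)) ((h , false) ∷ marked A) ++ map (label k) (marked B) ++ withDiag ρ′
      ≡⟨ cong ((h , false , suc k) ∷_) (sym (++-assoc (map (label (suc k)) (marked A)) _ _)) ⟩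
    (h , false , suc k) ∷ (map (label (suc k)) (marked A) ++ map (label k) (marked B)) ++ withDiag ρ′ ∎

below-not-hostB : ∀ {x k} it → Below x k it → ¬ HostB x k it
below-not-hostB (s , m , d) (_ , x≤s)   (_ , inj₁ (d≡k , s<x))   = <⇒≱ s<x (x≤s d≡k)
below-not-hostB (s , m , d) (d≤k , _)   (_ , inj₂ (d≡1+k , _))   = 1+n≰n (subst (_≤ _) d≡1+k d≤k)

witness : ∀ {A : Set} {P Q : A → Set} {xs} → Any P xs → All Q xs → ∃[ x ] (Q x × P x)
witness p qs = _ , All.lookupAny qs p

marked-first-unhosted : ∀ x τ → ¬ Any (HostB x (descents x (cars τ))) (withDiag ((x , true) ∷ τ))
marked-first-unhosted x τ (here (() , _))
marked-first-unhosted x τ (there host) with witness host (later-below x τ)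
... | it , below , hostB = below-not-hostB it below hostB

ascent : ∀ {x y} → x ≢ y → (y <ᵇ x) ≡ false → x < y
ascent x≢y y≮ᵇx = ≤∧≢⇒< (≮⇒≥ (λ y<x → subst T y≮ᵇx (<⇒<ᵇ y<x))) x≢y

no-descents-increasing : ∀ x ys → Unique (x ∷ ys) → descents x ys ≡ 0 → Linked _<_ (x ∷ ys)
no-descents-increasing x []       _                 _ = [-]
no-descents-increasing x (y ∷ ys) ((x≢y ∷ _) ∷ u) e with y <ᵇ x in y<ᵇx
... | false = ascent x≢y y<ᵇx ∷ no-descents-increasing y ys u e

without-last : ∀ {r} xs → Linked _<_ (xs ++ r ∷ []) → Linked _<_ xs
without-last []           _          = []
without-last (x ∷ [])     _          = [-]
without-last (x ∷ y ∷ xs) (x<y ∷ l) = x<y ∷ without-last (y ∷ xs) l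

unique-prefix : ∀ {xs ys : List ℕ} → Unique (xs ++ ys) → Unique xs
unique-prefix {[]}     _                = []
unique-prefix {x ∷ xs} (x∉ ∷ u) = Allₚ.++⁻ˡ xs x∉ ∷ unique-prefix u

unique-suffix : ∀ xs {ys : List ℕ} → Unique (xs ++ ys) → Unique ys
unique-suffix []       u       = u
unique-suffix (x ∷ xs) (_ ∷ u) = unique-suffix xs u

SplitAround : ℕ → List ℕ → Set
SplitAround r w = ∃[ A ] ∃[ B ] (w ≡ A ++ B × Linked _<_ A × Linked _<_ B × All (r <_) A × All (_< r) B)

split-no-descent : ∀ h ms r → Unique (h ∷ ms ++ r ∷ []) → descents h (ms ++ r ∷ []) ≡ 0 → SplitAround r (h ∷ ms)
split-no-descent h ms r u e =
  [] , h ∷ ms , refl , [] , without-last (h ∷ ms) increasing , [] , below-last (h ∷ ms) increasing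
  where increasing = no-descents-increasing h (ms ++ r ∷ []) u e

split-one-descent : ∀ h ms r → Unique (h ∷ ms ++ r ∷ []) → descents h (ms ++ r ∷ []) ≡ 1 → r < h →
  SplitAround r (h ∷ ms)
split-one-descent h []       r _                 _ r<h = h ∷ [] , [] , refl , [-] , [] , r<h ∷ [] , []
split-one-descent h (m ∷ ms) r ((h≢m ∷ _) ∷ u) e r<h with m <ᵇ h in m<ᵇh
... | true  = h ∷ [] , m ∷ ms , refl , [-] , without-last (m ∷ ms) increasing , r<h ∷ [] , below-last (m ∷ ms) increasing
  where increasing = no-descents-increasing m (ms ++ r ∷ []) u (suc-injective e)
... | false with ascent h≢m m<ᵇh
...   | h<m with split-one-descent m ms r u e (<-trans r<h h<m)
...     | [] , .(m ∷ ms) , refl , _ , _ , _ , m<r ∷ _ = ⊥-elim (<-asym m<r (<-trans r<h h<m))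
...     | .m ∷ A , B , refl , lA , lB , r<A , B<r = h ∷ m ∷ A , B , refl , h<m ∷ lA , lB , r<h ∷ r<A , B<r

descents-++ : ∀ x ys z zs → descents x (ys ++ z ∷ zs) ≡ descents x (ys ++ z ∷ []) + descents z zs
descents-++ x []       z zs = cong (_+ descents z zs) (sym (+-identityʳ _))
descents-++ x (y ∷ ys) z zs =
  trans (cong (_ +_) (descents-++ y ys z zs)) (sym (+-assoc (if y <ᵇ x then 1 else 0) _ _))

at-most-one-descent : ∀ {h r kr ys} D → (D + kr ≡ 0 ⊎ Any (HostA h (D + kr)) ys) → All (Below r kr) ys →
  D ≡ 0 ⊎ (D ≡ 1 × r < h)
at-most-one-descent zero    _          _     = inj₁ refl
at-most-one-descent (suc D) (inj₂ host) below with witness host below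
... | (s , m , d) , (d≤kr , r≤s) , (_ , inj₁ (1+d≡1+D+kr , s<h)) with D
...   | zero  = inj₂ (refl , ≤-<-trans (r≤s (suc-injective 1+d≡1+D+kr)) s<h)
...   | suc D′ = ⊥-elim (m+n≮n D′ _ (subst (_≤ _) (suc-injective 1+d≡1+D+kr) d≤kr))
at-most-one-descent {kr = kr} (suc D) (inj₂ host) below
  | (s , m , d) , (d≤kr , _) , (_ , inj₂ (d≡1+D+kr , _)) = ⊥-elim (m+n≮n D kr (subst (_≤ kr) d≡1+D+kr d≤kr))

HeadHosted : ℕ → List ℕ → MarkedWord → Set
HeadHosted h ms τ = descents h (ms ++ cars τ) ≡ 0 ⊎ Any (HostA h (descents h (ms ++ cars τ))) (withDiag τ)

-- Reading a segment h ∷ ms from left to right: marked cars extend it, and at the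
-- next unmarked car r the A-host condition of h splits h ∷ ms around r.
shape-from : ∀ h ms τ → Unique (h ∷ ms ++ cars τ) → HeadHosted h ms τ → HostedA (withDiag τ) →
  Shaped ((h , false) ∷ marked ms ++ τ)
shape-from h ms [] u (inj₁ e) _ =
  subst Shaped (cong ((h , false) ∷_) (sym (++-identityʳ (marked ms))))
    (final (h ∷ ms) (subst (λ w → Linked _<_ (h ∷ w)) (++-identityʳ ms) (no-descents-increasing h (ms ++ []) u e)))
shape-from h ms ((b , true) ∷ τ) u host hosted =
  subst Shaped (cong ((h , false) ∷_) extend)
    (shape-from h (ms ++ b ∷ []) τ (subst (λ w → Unique (h ∷ w)) assoc u)
      (subst (λ w → HeadHosted′ w) assoc (drop-marked host)) hosted)
  where
  assoc : ms ++ b ∷ cars τ ≡ (ms ++ b ∷ []) ++ cars τ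
  assoc = sym (++-assoc ms (b ∷ []) (cars τ))
  HeadHosted′ : List ℕ → Set
  HeadHosted′ w = descents h w ≡ 0 ⊎ Any (HostA h (descents h w)) (withDiag τ)
  drop-marked : HeadHosted h ms ((b , true) ∷ τ) → HeadHosted′ (ms ++ b ∷ cars τ)
  drop-marked (inj₁ e)                  = inj₁ e
  drop-marked (inj₂ (there a))          = inj₂ a
  extend : marked (ms ++ b ∷ []) ++ τ ≡ marked ms ++ (b , true) ∷ τ
  extend = trans (cong (_++ τ) (map-++ _ ms (b ∷ []))) (++-assoc (marked ms) _ τ)
shape-from h ms ((r , false) ∷ τ) u host (r-host , hosted)
  with split (at-most-one-descent D (subst (λ k → k ≡ 0 ⊎ Any (HostA h k) _) (descents-++ h ms r (cars τ)) host)
                                    ((≤-refl , const ≤-refl) ∷ later-below r τ))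
  where
  D = descents h (ms ++ r ∷ [])
  u-segment : Unique (h ∷ ms ++ r ∷ [])
  u-segment = unique-prefix {h ∷ ms ++ r ∷ []} (subst (λ w → Unique (h ∷ w)) (sym (++-assoc ms (r ∷ []) (cars τ))) u)
  split : D ≡ 0 ⊎ (D ≡ 1 × r < h) → SplitAround r (h ∷ ms)
  split (inj₁ D≡0)         = split-no-descent h ms r u-segment D≡0
  split (inj₂ (D≡1 , r<h)) = split-one-descent h ms r u-segment D≡1 r<h
... | A , B , h∷ms≡A++B , lA , lB , r<A , B<r =
  subst (λ w → Shaped (markSegment w ++ (r , false) ∷ τ)) (sym h∷ms≡A++B)
    (more A B r τ lA lB r<A B<r (shape-from r [] τ (unique-suffix (h ∷ ms) u) r-host hosted))

hosted→shaped : ∀ τ → Unique (cars τ) → Hosted (withDiag τ) → Shaped τ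
hosted→shaped []               _ _                              = final [] []
hosted→shaped ((x , true) ∷ τ)  _ (_ , x-hosted ∷ _)            = ⊥-elim (marked-first-unhosted x τ (x-hosted refl))
hosted→shaped ((h , false) ∷ τ) u ((h-host , hostedA) , _)     = shape-from h [] τ u h-host hostedA

hosted⇔shaped : ∀ τ → Unique (cars τ) → Hosted (withDiag τ) ⇔ Shaped τ
hosted⇔shaped τ u = mk⇔ (hosted→shaped τ u) (λ s → shaped→hosted s (λ it∈ → it∈))

arrange-around : ∀ A B r t → All (r <_) A → All (_< r) B → arrange (B ++ A) (r ∷ t) ≡ A ++ B
arrange-around A B r t r<A B<r = cong₂ _++_
  (begin
    filterᵇ (r <ᵇ_) (B ++ A)                    ≡⟨ filter-++ (T? ∘ (r <ᵇ_)) B A ⟩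
    filterᵇ (r <ᵇ_) B ++ filterᵇ (r <ᵇ_) A      ≡⟨ cong₂ _++_ (filter-none (T? ∘ (r <ᵇ_)) (All.map (λ b<r t → <-asym b<r (<ᵇ⇒< r _ t)) B<r))
                                                                (filter-all (T? ∘ (r <ᵇ_)) (All.map <⇒<ᵇ r<A)) ⟩
    A ∎)
  (begin
    filterᵇ (_<ᵇ r) (B ++ A)                    ≡⟨ filter-++ (T? ∘ (_<ᵇ r)) B A ⟩
    filterᵇ (_<ᵇ r) B ++ filterᵇ (_<ᵇ r) A      ≡⟨ cong₂ _++_ (filter-all (T? ∘ (_<ᵇ r)) (All.map <⇒<ᵇ B<r))
                                                                (filter-none (T? ∘ (_<ᵇ r)) (All.map (λ r<a t → <-asym r<a (<ᵇ⇒< _ r t)) r<A)) ⟩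
    B ++ []                                     ≡⟨ ++-identityʳ B ⟩
    B ∎)

arrange-splits : ∀ C r → Linked _<_ C →
  Linked _<_ (filterᵇ (r <ᵇ_) C) × Linked _<_ (filterᵇ (_<ᵇ r) C)
  × All (r <_) (filterᵇ (r <ᵇ_) C) × All (_< r) (filterᵇ (_<ᵇ r) C)
arrange-splits C r l =
    Linkedₚ.filter⁺ (T? ∘ (r <ᵇ_)) <-trans l , Linkedₚ.filter⁺ (T? ∘ (_<ᵇ r)) <-trans l
  , All.map (<ᵇ⇒< r _) (Allₚ.all-filter (T? ∘ (r <ᵇ_)) C) , All.map (<ᵇ⇒< _ r) (Allₚ.all-filter (T? ∘ (_<ᵇ r)) C)

first-unmarked : ∀ {τ x m ρ} → Shaped τ → τ ≡ (x , m) ∷ ρ → m ≡ false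
first-unmarked (final (y ∷ w) _)            refl = refl
first-unmarked (more []      []      _ _ _ _ _ _ _) refl = refl
first-unmarked (more []      (y ∷ B) _ _ _ _ _ _ _) refl = refl
first-unmarked (more (y ∷ A) B       _ _ _ _ _ _ _) refl = refl

cars-markSegment : ∀ w → cars (markSegment w) ≡ w
cars-markSegment []       = refl
cars-markSegment (x ∷ xs) = cars-segment x false xs

cars-tauStar : ∀ Π → cars (tauStar Π) ≡ tau Π
cars-tauStar Π = cars-segments (segments Π)
  where
  cars-segments : ∀ ss → cars (concatMap markSegment ss) ≡ concat ss
  cars-segments []       = refl
  cars-segments (s ∷ ss) = begin
    cars (markSegment s ++ concatMap markSegment ss)          ≡⟨ map-++ proj₁ (markSegment s) _ ⟩
    cars (markSegment s) ++ cars (concatMap markSegment ss)  ≡⟨ cong₂ _++_ (cars-markSegment s) (cars-segments ss) ⟩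
    s ++ concat ss                                            ∎

tauStar-shaped : ∀ Π → All (Linked _<_) Π → Shaped (tauStar Π)
tauStar-shaped []          []       = final [] []
tauStar-shaped (C ∷ [])     (l ∷ _)  = subst Shaped (sym (++-identityʳ (markSegment C))) (final C l)
tauStar-shaped (C ∷ D ∷ Π) (l ∷ ls) =
  subst (λ t → Shaped (markSegment (arrange C t) ++ tauStar (D ∷ Π))) (cars-tauStar (D ∷ Π))
    (prepend (tauStar (D ∷ Π)) (tauStar-shaped (D ∷ Π) ls))
  where
  prepend : ∀ τ → Shaped τ → Shaped (markSegment (arrange C (cars τ)) ++ τ)
  prepend [] _ = subst Shaped (sym (++-identityʳ (markSegment C))) (final C l)
  prepend ((r , m) ∷ ρ) s with first-unmarked s refl
  ... | refl with arrange-splits C r l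
  ...   | lA , lB , r<A , B<r = more _ _ r ρ lA lB r<A B<r s

no-blocks : IsOrderedSetPartitionOf [] []
no-blocks = [] , [] , (λ _ ()) , (λ _ ())

partition-cons : ∀ {C C′ Π S} → IsBlock C → (∀ {x} → x ∈ C → x ∈ C′) → (∀ {x} → x ∈ C′ → x ∈ C) →
  (∀ {x} → x ∈ C′ → x ∉ S) → IsOrderedSetPartitionOf Π S → IsOrderedSetPartitionOf (C ∷ Π) (C′ ++ S)
partition-cons {C} {C′} {Π} {S} block C⊆C′ C′⊆C C′∉S (blocks , disjoint , covers , covered) =
  block ∷ blocks , All.tabulate apart ∷ disjoint , covers′ , covered′
  where
  apart : ∀ {D} → D ∈ Π → ∀ {x} → x ∈ C → x ∉ D
  apart D∈Π {x} x∈C x∈D = C′∉S (C⊆C′ x∈C) (covered x (lose {P = x ∈_} D∈Π x∈D))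
  covers′ : ∀ x → x ∈ C′ ++ S → Any (x ∈_) (C ∷ Π)
  covers′ x x∈ = [ here ∘ C′⊆C , there ∘ covers x ]′ (∈-++⁻ C′ x∈)
  covered′ : ∀ x → Any (x ∈_) (C ∷ Π) → x ∈ C′ ++ S
  covered′ x (here x∈C) = ∈-++⁺ˡ (C⊆C′ x∈C)
  covered′ x (there a)  = ∈-++⁺ʳ C′ (covered x a)

unique-disjoint : ∀ xs {ys : List ℕ} → Unique (xs ++ ys) → ∀ {x} → x ∈ xs → x ∉ ys
unique-disjoint (z ∷ xs) (z∉ ∷ _) (here refl) x∈ys = All.lookup z∉ (∈-++⁺ʳ xs x∈ys) refl
unique-disjoint (z ∷ xs) (_ ∷ u)  (there x∈xs) x∈ys = unique-disjoint xs u x∈xs x∈ys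

Partitioned : MarkedWord → Set
Partitioned τ = ∃[ Π ] (IsOrderedSetPartitionOf Π (cars τ) × tauStar Π ≡ τ)

-- a nonempty segment A ++ B before r contributes the block B ++ A
prepend-block : ∀ A B r ρ → Linked _<_ A → Linked _<_ B → All (r <_) A → All (_< r) B → B ++ A ≢ [] →
  (Unique (cars ((r , false) ∷ ρ)) → Partitioned ((r , false) ∷ ρ)) →
  Unique (cars (markSegment (A ++ B) ++ (r , false) ∷ ρ)) → Partitioned (markSegment (A ++ B) ++ (r , false) ∷ ρ)
prepend-block A B r ρ lA lB r<A B<r nonempty partition-rest u =
  extend (partition-rest (unique-suffix (A ++ B) u′))
  where
  ρ′ = (r , false) ∷ ρ
  cars-eq : cars (markSegment (A ++ B) ++ ρ′) ≡ (A ++ B) ++ cars ρ′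
  cars-eq = trans (map-++ proj₁ (markSegment (A ++ B)) ρ′) (cong (_++ cars ρ′) (cars-markSegment (A ++ B)))
  u′ = subst Unique cars-eq u
  increasing : Linked _<_ (B ++ A)
  increasing = AllPairs⇒Linked (AllPairsₚ.++⁺ (Linked⇒AllPairs <-trans lB) (Linked⇒AllPairs <-trans lA)
                                            (All.map (λ b<r → All.map (<-trans b<r) r<A) B<r))
  extend : Partitioned ρ′ → Partitioned (markSegment (A ++ B) ++ ρ′)
  extend ([] , _ , ())
  extend (D ∷ Π , partition , τ*≡ρ′) =
    (B ++ A) ∷ D ∷ Π
    , subst (IsOrderedSetPartitionOf ((B ++ A) ∷ D ∷ Π)) (sym cars-eq)
        (partition-cons (nonempty , increasing) (any-++-comm B A) (any-++-comm A B) (unique-disjoint (A ++ B) u′)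
          partition)
    , cong₂ _++_ (cong markSegment (trans (cong (arrange (B ++ A)) tau-eq) (arrange-around A B r (cars ρ) r<A B<r))) τ*≡ρ′
    where
    tau-eq : tau (D ∷ Π) ≡ r ∷ cars ρ
    tau-eq = trans (sym (cars-tauStar (D ∷ Π))) (cong cars τ*≡ρ′)

shaped→partitioned : ∀ {τ} → Shaped τ → Unique (cars τ) → Partitioned τ
shaped→partitioned (final [] _) _ = [] , no-blocks , refl
shaped→partitioned (final (h ∷ w) l) _ =
  (h ∷ w) ∷ []
  , subst (IsOrderedSetPartitionOf ((h ∷ w) ∷ [])) (trans (++-identityʳ _) (sym (cars-markSegment (h ∷ w))))
      (partition-cons ((λ ()) , l) id id (λ _ ()) no-blocks)
  , ++-identityʳ _
shaped→partitioned (more [] [] r ρ _ _ _ _ s) u = shaped→partitioned s u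
shaped→partitioned (more [] (b ∷ B) r ρ lA lB r<A B<r s) u =
  prepend-block [] (b ∷ B) r ρ lA lB r<A B<r (λ ()) (shaped→partitioned s) u
shaped→partitioned (more (a ∷ A) B r ρ lA lB r<A B<r s) u =
  prepend-block (a ∷ A) B r ρ lA lB r<A B<r ((λ ()) ∘ ++-conicalʳ B (a ∷ A)) (shaped→partitioned s) u

shaped⇔partitioned : ∀ τ → Unique (cars τ) → Shaped τ ⇔ Partitioned τ
shaped⇔partitioned τ u = mk⇔ (λ s → shaped→partitioned s u)
  (λ (Π , (blocks , _) , τ*≡τ) → subst Shaped τ*≡τ (tauStar-shaped Π (All.map proj₂ blocks)))

theorem3p11 : (τ : List (ℕ × Bool)) → IsMarkedPerm τ →
    Insertable τ ⇔ (∃[ Π ] (IsOrderedSetPartitionOf Π (map proj₁ τ) × tauStar Π ≡ τ))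
theorem3p11 τ perm@(distinct , _) =
  shaped⇔partitioned τ distinct ⇔-∘ (hosted⇔shaped τ distinct ⇔-∘ insertable⇔hosted τ perm)
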